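{- Let $F$ be a tract satisfying the Inflation Property. Then the operation defined, for every finite set $E$ and $X,Y\in F^E$, by $(X\circ Y)(e)=X(e)$ if $X(e)\ne0$ and $(X\circ Y)(e)=Y(e)$ otherwise, is a composition operation on $F$.
   Context: A tract is a multiplicative group $G$ with $N_G\subseteq\mathbb N[G]$ such that $0\in N_G$, $1\notin N_G$, there is a unique $\eta\in G$ with $1+\eta\in N_G$, and $N_G$ is closed under multiplication by $G$; $F=G\cup\{0\}$ with a conjugation $x\mapsto x^c$ (involutive automorphism). Inner product $X\cdot Y=\sum_eX(e)Y(e)^c\in\mathbb N[G]$ (zero terms dropped); $X\perp Y$ iff $X\cdot Y\in N_G$; $Z^\perp=\{X: X\perp Z\}$; $\underline X=\{e:X(e)\ne0\}$. The Inflation Property: whenever $\sum_{j=1}^ka_j\in N_G-\{0\}$, we have $b+\sum_ja_j\in N_G$ for all $b\in G$. A composition operation on $F$ assigns to every finite $E$ and $X_1,X_2\in F^E$ a nonempty subset $X_1\circ_FX_2\subseteq F^E$ (a single-valued operation is viewed as singleton-valued) such that (i) every $Y\in X_1\circ_FX_2$ has $\underline Y=\underline{X_1}\cup\underline{X_2}$, and (ii) if $X_1,X_2\in Z^\perp$ then $X_1\circ_FX_2\subseteq Z^\perp$. -}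

module Defs where

open import Data.Nat using (ℕ)
open import Data.Fin using (Fin)
open import Data.List using (List; []; _∷_; _++_; map; concat; allFin)
open import Data.List.Relation.Binary.Permutation.Propositional using (_↭_)
open import Data.Maybe using (Maybe; just; nothing)
open import Data.Product using (Σ; ∃; _×_)
open import Data.Sum using (_⊎_)
open import Relation.Binary.PropositionalEquality using (_≡_; _≢_)
open import Relation.Nullary using (¬_)
open import Algebra.Structures using (IsAbelianGroup)

-- Elements of ℕ[G] are finite multisets of elements of G, represented as
-- lists considered up to permutation (_↭_).  Sum in ℕ[G] is _++_, the zero
-- element is [], and g·(a₁+…+aₖ) = g·a₁+…+g·aₖ is `map (g ·_)`.

record Tract : Set₁ where
  field
    G        : Set
    _·_      : G → G → G
    ε        : G
    _⁻¹      : G → G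
    isAbelianGroup : IsAbelianGroup _≡_ _·_ ε _⁻¹
    N        : List G → Set
    N-perm   : ∀ {xs ys} → xs ↭ ys → N xs → N ys
    N-zero   : N []
    N-one    : ¬ N (ε ∷ [])
    η        : G
    N-η      : N (ε ∷ η ∷ [])
    η-unique : ∀ g → N (ε ∷ g ∷ []) → g ≡ η
    N-mult   : ∀ g xs → N xs → N (map (g ·_) xs)
    -- conjugation: an involutive automorphism of F = G ∪ {0}
    -- (it fixes 0, so it is given by an involutive automorphism of G)
    conj     : G → G
    conj-hom : ∀ x y → conj (x · y) ≡ conj x · conj y
    conj-inv : ∀ x → conj (conj x) ≡ x

module _ (T : Tract) where
  open Tract T

  -- F = G ∪ {0}, with 0 = nothing
  F : Set
  F = Maybe G

  InflationProperty : Set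
  InflationProperty = ∀ (as : List G) → N as → as ≢ [] → ∀ (b : G) → N (b ∷ as)

  -- the term X(e)·Y(e)^c of the inner product (zero terms dropped)
  term : F → F → List G
  term (just x) (just y) = (x · conj y) ∷ []
  term _        _        = []

  inner : ∀ {n} → (Fin n → F) → (Fin n → F) → List G
  inner {n} X Y = concat (map (λ e → term (X e) (Y e)) (allFin n))

  _⊥_ : ∀ {n} → (Fin n → F) → (Fin n → F) → Set
  X ⊥ Y = N (inner X Y)

  NonZero : F → Set
  NonZero x = x ≢ nothing

  -- A (multivalued) composition operation: `R X₁ X₂ Y` means Y ∈ X₁ ∘ X₂.
  record IsCompositionOperation
      (R : ∀ {n} → (Fin n → F) → (Fin n → F) → (Fin n → F) → Set) : Set where
    field
      nonempty : ∀ {n} (X₁ X₂ : Fin n → F) → ∃ λ Y → R X₁ X₂ Y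
      support  : ∀ {n} (X₁ X₂ Y : Fin n → F) → R X₁ X₂ Y → ∀ e →
                   (NonZero (Y e) → NonZero (X₁ e) ⊎ NonZero (X₂ e))
                 × (NonZero (X₁ e) ⊎ NonZero (X₂ e) → NonZero (Y e))
      orth     : ∀ {n} (X₁ X₂ Y Z : Fin n → F) → R X₁ X₂ Y →
                   X₁ ⊥ Z → X₂ ⊥ Z → Y ⊥ Z

  Singleton : (∀ {n} → (Fin n → F) → (Fin n → F) → (Fin n → F))
            → ∀ {n} → (Fin n → F) → (Fin n → F) → (Fin n → F) → Set
  Singleton f X₁ X₂ Y = ∀ e → Y e ≡ f X₁ X₂ e

  pick : F → F → F
  pick (just x) _ = just x
  pick nothing  y = y

  leftComp : ∀ {n} → (Fin n → F) → (Fin n → F) → (Fin n → F)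
  leftComp X Y e = pick (X e) (Y e)

-- (X₁ ∘ X₂)·Z = X₁·Z + R, where R collects the terms X₂(e)Z(e)^c at those e outside the support
-- of X₁.  If X₁·Z = 0 then X₁(e)Z(e) = 0 for every e, so R = X₂·Z ∈ N_G.  Otherwise
-- X₁·Z ∈ N_G − {0}, and the Inflation Property adds the terms of R one at a time without leaving N_G.
module Submission where

open import Defs
open import Data.Fin using (Fin)
open import Data.List using (List; []; _∷_; _++_; concatMap; allFin)
open import Data.List.Properties using (++-assoc; ++-conicalˡ; ++-conicalʳ; concatMap-cong)
open import Data.List.Relation.Binary.Permutation.Propositional
  using (_↭_; ↭-refl; ↭-sym; ↭-trans; ↭-reflexive; module PermutationReasoning)
open import Data.List.Relation.Binary.Permutation.Propositional.Properties
  using (++⁺ˡ; shifts; ++-comm)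
open import Data.Maybe using (just; nothing)
open import Data.Product using (_,_)
open import Data.Sum using (_⊎_; inj₁; inj₂)
open import Relation.Binary.PropositionalEquality using (_≡_; _≢_; refl; sym; cong; cong₂; subst)

concatMap-++ : {I A : Set} (f g : I → List A) (is : List I) →
  concatMap (λ i → f i ++ g i) is ↭ concatMap f is ++ concatMap g is
concatMap-++ f g [] = ↭-refl
concatMap-++ f g (i ∷ is) = begin
  (f i ++ g i) ++ concatMap (λ i → f i ++ g i) is  ≡⟨ ++-assoc (f i) (g i) _ ⟩
  f i ++ g i ++ concatMap (λ i → f i ++ g i) is    ↭⟨ ++⁺ˡ (f i) (++⁺ˡ (g i) (concatMap-++ f g is)) ⟩
  f i ++ g i ++ concatMap f is ++ concatMap g is   ↭⟨ ++⁺ˡ (f i) (shifts (g i) (concatMap f is)) ⟩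
  f i ++ concatMap f is ++ g i ++ concatMap g is   ≡⟨ ++-assoc (f i) (concatMap f is) _ ⟨
  (f i ++ concatMap f is) ++ g i ++ concatMap g is ∎
  where open PermutationReasoning

concatMap-cong-on-null : {I A B : Set} (f : I → List A) (g h : I → List B) (is : List I) →
  (∀ i → f i ≡ [] → g i ≡ h i) → concatMap f is ≡ [] → concatMap g is ≡ concatMap h is
concatMap-cong-on-null f g h []       g≡h null = refl
concatMap-cong-on-null f g h (i ∷ is) g≡h null = cong₂ _++_
  (g≡h i (++-conicalˡ (f i) _ null))
  (concatMap-cong-on-null f g h is g≡h (++-conicalʳ (f i) _ null))

module _ (T : Tract) where
  open Tract T

  N-++ˡ-inflation : InflationProperty T → ∀ bs {as} → N as → as ≢ [] → N (bs ++ as)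
  N-++ˡ-inflation infl []       Nas as≢[] = Nas
  N-++ˡ-inflation infl (b ∷ bs) {as} Nas as≢[] = infl (bs ++ as) (N-++ˡ-inflation infl bs Nas as≢[])
    (λ bs++as≡[] → as≢[] (++-conicalʳ bs _ bs++as≡[])) b

  N-++-inflation : InflationProperty T → ∀ {as} bs → N as → (as ≡ [] → N bs) → N (as ++ bs)
  N-++-inflation infl {[]}    bs Nas Nbs = Nbs refl
  N-++-inflation infl {a ∷ as} bs Nas Nbs =
    N-perm (++-comm bs (a ∷ as)) (N-++ˡ-inflation infl bs Nas (λ ()))

  termOutside : F T → F T → F T → List G
  termOutside nothing  y z = term T y z
  termOutside (just _) y z = []

  term-pick : ∀ x y z → term T (pick T x y) z ≡ term T x z ++ termOutside x y z
  term-pick nothing  y z        = refl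
  term-pick (just x) y nothing  = refl
  term-pick (just x) y (just z) = refl

  termOutside-null : ∀ x y z → term T x z ≡ [] → termOutside x y z ≡ term T y z
  termOutside-null nothing  y        z        null = refl
  termOutside-null (just x) nothing  nothing  null = refl
  termOutside-null (just x) (just y) nothing  null = refl
  termOutside-null (just x) y        (just z) ()

  innerOutside : ∀ {n} → (Fin n → F T) → (Fin n → F T) → (Fin n → F T) → List G
  innerOutside X₁ X₂ Z = concatMap (λ e → termOutside (X₁ e) (X₂ e) (Z e)) (allFin _)

  module _ {n} (X₁ X₂ Z : Fin n → F T) where

    inner-leftComp : inner T (leftComp T X₁ X₂) Z ↭ inner T X₁ Z ++ innerOutside X₁ X₂ Z
    inner-leftComp = ↭-trans
      (↭-reflexive (concatMap-cong (λ e → term-pick (X₁ e) (X₂ e) (Z e)) (allFin n)))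
      (concatMap-++ (λ e → term T (X₁ e) (Z e)) (λ e → termOutside (X₁ e) (X₂ e) (Z e)) (allFin n))

    innerOutside-null : inner T X₁ Z ≡ [] → innerOutside X₁ X₂ Z ≡ inner T X₂ Z
    innerOutside-null = concatMap-cong-on-null _ _ _ (allFin n)
      (λ e → termOutside-null (X₁ e) (X₂ e) (Z e))

    leftComp-⊥ : InflationProperty T → _⊥_ T X₁ Z → _⊥_ T X₂ Z → _⊥_ T (leftComp T X₁ X₂) Z
    leftComp-⊥ infl X₁⊥Z X₂⊥Z = N-perm (↭-sym inner-leftComp)
      (N-++-inflation infl (innerOutside X₁ X₂ Z) X₁⊥Z
        (λ null → subst N (sym (innerOutside-null null)) X₂⊥Z))

  inner-congˡ : ∀ {n} {X X′ : Fin n → F T} (Z : Fin n → F T) →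
    (∀ e → X e ≡ X′ e) → inner T X Z ≡ inner T X′ Z
  inner-congˡ {n} Z X≡X′ = concatMap-cong (λ e → cong (λ x → term T x (Z e)) (X≡X′ e)) (allFin n)

  pick-nonZero : ∀ x y → NonZero T (pick T x y) → NonZero T x ⊎ NonZero T y
  pick-nonZero (just x) y nz = inj₁ nz
  pick-nonZero nothing  y nz = inj₂ nz

  nonZero-pick : ∀ x y → NonZero T x ⊎ NonZero T y → NonZero T (pick T x y)
  nonZero-pick (just x) y nz        = λ ()
  nonZero-pick nothing  y (inj₁ nz) = λ _ → nz refl
  nonZero-pick nothing  y (inj₂ nz) = nz

proposition7p12 : (T : Tract) → InflationProperty T
    → IsCompositionOperation T (Singleton T (leftComp T))
proposition7p12 T infl = record
  { nonempty = λ X₁ X₂ → leftComp T X₁ X₂ , λ _ → refl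
  ; support  = λ X₁ X₂ Y Y≡ e →
      (λ nz → pick-nonZero T (X₁ e) (X₂ e) (subst (NonZero T) (Y≡ e) nz))
    , (λ nz → subst (NonZero T) (sym (Y≡ e)) (nonZero-pick T (X₁ e) (X₂ e) nz))
  ; orth     = λ X₁ X₂ Y Z Y≡ X₁⊥Z X₂⊥Z →
      subst (Tract.N T) (sym (inner-congˡ T Z Y≡)) (leftComp-⊥ T X₁ X₂ Z infl X₁⊥Z X₂⊥Z)
  }
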